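{- Let $b\geq 2$ be an integer and $F:\mathbb{N}\to\mathbb{N}$ a function such that $\displaystyle\lim_{n\to+\infty}\frac{F(n)}{b^{\frac{n-b+1}{b-1}}}=0$. Then there are finitely many base $b$ $F$-Dudeney numbers. In particular, if $F\in\mathbb{Q}[X]$ is a polynomial such that $F(n)\in\mathbb{N}$ for all $n\in\mathbb{N}$, then there are finitely many base $b$ $F$-Dudeney numbers.
   Context: For a non-negative integer $x=\sum_{i=0}^{m-1}a_ib^i$ written in base $b$ (digits $0\le a_i\le b-1$), $S_b(x)=\sum_{i=0}^{m-1}a_i$ is its base-$b$ digit sum. A natural number $n$ is a base $b$ $F$-Dudeney number if $n=S_b(F(n))$. -}

module Defs where

open import Data.Nat using (ℕ; zero; suc; _+_; _*_; _∸_; _^_; _≤_; _<_; NonZero)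
open import Data.Nat.DivMod using (_/_; _%_)
open import Data.Integer using (+_)
open import Data.Rational using (ℚ; 0ℚ) renaming (_+_ to _+ℚ_; _*_ to _*ℚ_; _/_ to _/ℚ_)
open import Data.List using (List; []; _∷_)
open import Data.Product using (∃)
open import Relation.Binary.PropositionalEquality using (_≡_)

-- Computed by repeated division with fuel; fuel x suffices when b ≥ 2
-- (each step strictly decreases a positive argument, and go f 0 = 0).
digitSumGo : (b : ℕ) → .{{_ : NonZero b}} → ℕ → ℕ → ℕ
digitSumGo b zero    x = zero
digitSumGo b (suc f) x = x % b + digitSumGo b f (x / b)

S : (b : ℕ) → .{{_ : NonZero b}} → ℕ → ℕ
S b x = digitSumGo b x x

IsDudeney : (b : ℕ) → .{{_ : NonZero b}} → (ℕ → ℕ) → ℕ → Set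
IsDudeney b F n = n ≡ S b (F n)

FinitelyMany : (ℕ → Set) → Set
FinitelyMany P = ∃ λ N → ∀ n → P n → n < N

-- f(n)/g(n) → 0 for g positive: for every ε = 1/(k+1) eventually
-- (k+1)·f(n) < g(n).
RatioTendsToZero : (ℕ → ℕ) → (ℕ → ℕ) → Set
RatioTendsToZero f g = ∀ k → ∃ λ N → ∀ n → N ≤ n → suc k * f n < g n

ℕtoℚ : ℕ → ℚ
ℕtoℚ n = (+ n) /ℚ 1

-- polynomial with rational coefficients, coefficient list (constant term first)
evalPoly : List ℚ → ℚ → ℚ
evalPoly []       x = 0ℚ
evalPoly (c ∷ cs) x = c +ℚ (x *ℚ evalPoly cs x)

{-# OPTIONS --safe #-}
module Submission where

-- Splitting off the last digit, x = r + q b with r ≤ b − 1, shows inductively that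
-- b^S_b(x) ≤ x^(b − 1) b^(b − 1) for x ≥ 1.
-- A Dudeney number n = S_b(F n) with n ≥ 1 therefore satisfies b^n ≤ (b F(n))^(b − 1), which the
-- hypothesis on F rules out for large n. A polynomial F ∈ ℚ[X] with values in ℕ is bounded by
-- C (n + 1)^d, and 2^n eventually dominates every such bound, so F satisfies that hypothesis.

open import Defs
open import Data.Nat
open import Data.Nat.Properties
open import Data.Nat.DivMod using (_/_; _%_; 0/n≡0; m<n⇒m%n≡m; m%n<n; m/n*n≤m)
open import Data.Nat.Coprimality using (1-coprimeTo) renaming (sym to coprime-sym)
open import Algebra.Properties.CommutativeSemigroup *-commutativeSemigroup
  using (interchange; x∙yz≈y∙xz; x∙yz≈xz∙y; xy∙z≈xz∙y)
import Data.Integer as ℤ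
import Data.Integer.Properties as ℤ
open import Data.Rational as ℚ using (ℚ; mkℚ)
import Data.Rational.Properties as ℚ
open import Data.List using (List; []; _∷_; length)
open import Data.Product using (∃; ∃₂; _×_; _,_)
open import Function using (_∘_)
open import Relation.Nullary using (¬_; yes; no; contradiction)
open import Relation.Binary.PropositionalEquality

Eventually : (ℕ → Set) → Set
Eventually P = ∃ λ N → ∀ n → N ≤ n → P n

eventually¬⇒finitelyMany : ∀ {P : ℕ → Set} → Eventually (¬_ ∘ P) → FinitelyMany P
eventually¬⇒finitelyMany {P} (N , ¬P) = N , bounded
  where
  bounded : ∀ n → P n → n < N
  bounded n Pn with n <? N
  ... | yes n<N = n<N
  ... | no  n≮N = contradiction Pn (¬P n (≮⇒≥ n≮N))

^-distribʳ-* : ∀ m n k → (m * n) ^ k ≡ m ^ k * n ^ k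
^-distribʳ-* m n zero    = refl
^-distribʳ-* m n (suc k) = begin
  m * n * (m * n) ^ k        ≡⟨ cong (m * n *_) (^-distribʳ-* m n k) ⟩
  m * n * (m ^ k * n ^ k)    ≡⟨ interchange m n (m ^ k) (n ^ k) ⟩
  m * m ^ k * (n * n ^ k)    ∎
  where open ≡-Reasoning

digitSumGo-zero : ∀ b .{{_ : NonZero b}} fuel → digitSumGo b fuel 0 ≡ 0
digitSumGo-zero b zero       = refl
digitSumGo-zero b (suc fuel) = begin
  0 % b + digitSumGo b fuel (0 / b)   ≡⟨ cong (λ q → 0 % b + digitSumGo b fuel q) (0/n≡0 b) ⟩
  0 % b + digitSumGo b fuel 0         ≡⟨ cong₂ _+_ (m<n⇒m%n≡m (>-nonZero⁻¹ b)) (digitSumGo-zero b fuel) ⟩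
  0                                   ∎
  where open ≡-Reasoning

b^[x%b]≤b^[b∸1] : ∀ b .{{_ : NonZero b}} x → b ^ (x % b) ≤ b ^ (b ∸ 1)
b^[x%b]≤b^[b∸1] b x = ^-monoʳ-≤ b (<⇒≤pred (m%n<n x b))

b^digitSumGo≤x^[b∸1]*b^[b∸1] : ∀ b .{{_ : NonZero b}} fuel x → .{{NonZero x}} →
                                b ^ digitSumGo b fuel x ≤ x ^ (b ∸ 1) * b ^ (b ∸ 1)
b^digitSumGo≤x^[b∸1]*b^[b∸1] b zero x = *-mono-≤ (m^n>0 x (b ∸ 1)) (m^n>0 b (b ∸ 1))
b^digitSumGo≤x^[b∸1]*b^[b∸1] b (suc fuel) x with x / b in x/b≡q
... | zero = begin
  b ^ (x % b + digitSumGo b fuel 0)   ≡⟨ cong (λ s → b ^ (x % b + s)) (digitSumGo-zero b fuel) ⟩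
  b ^ (x % b + 0)                     ≡⟨ cong (b ^_) (+-identityʳ (x % b)) ⟩
  b ^ (x % b)                         ≤⟨ b^[x%b]≤b^[b∸1] b x ⟩
  b ^ B                               ≤⟨ m≤n*m (b ^ B) (x ^ B) {{m^n≢0 x B}} ⟩
  x ^ B * b ^ B                       ∎
  where
  open ≤-Reasoning
  B = b ∸ 1
... | suc q = begin
  b ^ (x % b + digitSumGo b fuel (suc q))       ≡⟨ ^-distribˡ-+-* b (x % b) _ ⟩
  b ^ (x % b) * b ^ digitSumGo b fuel (suc q)   ≤⟨ *-mono-≤ (b^[x%b]≤b^[b∸1] b x)
                                                             (b^digitSumGo≤x^[b∸1]*b^[b∸1] b fuel (suc q)) ⟩
  b ^ B * (suc q ^ B * b ^ B)                   ≡⟨ *-comm (b ^ B) _ ⟩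
  suc q ^ B * b ^ B * b ^ B                     ≡⟨ cong (_* b ^ B) (^-distribʳ-* (suc q) b B) ⟨
  (suc q * b) ^ B * b ^ B                       ≤⟨ *-monoˡ-≤ (b ^ B) (^-monoˡ-≤ B qb≤x) ⟩
  x ^ B * b ^ B                                 ∎
  where
  open ≤-Reasoning
  B = b ∸ 1
  qb≤x : suc q * b ≤ x
  qb≤x = subst (λ q → q * b ≤ x) x/b≡q (m/n*n≤m x b)

b^n≤F[n]^[b∸1]*b^[b∸1] : ∀ b .{{_ : NonZero b}} F n → .{{NonZero n}} → IsDudeney b F n →
                          b ^ n ≤ F n ^ (b ∸ 1) * b ^ (b ∸ 1)
b^n≤F[n]^[b∸1]*b^[b∸1] b F n@(suc _) n≡S[Fn] with F n
... | zero  = contradiction n≡S[Fn] λ ()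
... | suc y = subst (λ m → b ^ m ≤ suc y ^ (b ∸ 1) * b ^ (b ∸ 1)) (sym n≡S[Fn])
                    (b^digitSumGo≤x^[b∸1]*b^[b∸1] b (suc y) (suc y))

dudeney-finitelyMany : ∀ b .{{_ : NonZero b}} F →
                       RatioTendsToZero (λ n → F n ^ (b ∸ 1) * b ^ (b ∸ 1)) (b ^_) →
                       FinitelyMany (IsDudeney b F)
dudeney-finitelyMany b F ratio→0 with ratio→0 0
... | N , F[n]^[b∸1]*b^[b∸1]<b^n = eventually¬⇒finitelyMany (suc N , notDudeney)
  where
  notDudeney : ∀ n → N < n → ¬ IsDudeney b F n
  notDudeney n@(suc _) N<n isDudeney = <⇒≱ (F[n]^[b∸1]*b^[b∸1]<b^n n (<⇒≤ N<n)) (begin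
    b ^ n                                ≤⟨ b^n≤F[n]^[b∸1]*b^[b∸1] b F n isDudeney ⟩
    F n ^ (b ∸ 1) * b ^ (b ∸ 1)          ≡⟨ *-identityˡ _ ⟨
    1 * (F n ^ (b ∸ 1) * b ^ (b ∸ 1))    ∎)
    where open ≤-Reasoning

n<2^n : ∀ n → n < 2 ^ n
n<2^n zero    = z<s
n<2^n (suc n) = ≤-<-trans (n<2^n n) (^-monoʳ-< 2 (s<s z<s) (n<1+n n))

⌊n/2⌋+⌊n/2⌋≤n : ∀ n → ⌊ n /2⌋ + ⌊ n /2⌋ ≤ n
⌊n/2⌋+⌊n/2⌋≤n n = begin
  ⌊ n /2⌋ + ⌊ n /2⌋   ≤⟨ +-monoʳ-≤ ⌊ n /2⌋ (⌊n/2⌋≤⌈n/2⌉ n) ⟩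
  ⌊ n /2⌋ + ⌈ n /2⌉   ≡⟨ ⌊n/2⌋+⌈n/2⌉≡n n ⟩
  n                   ∎
  where open ≤-Reasoning

1+n≤2*[1+⌊n/2⌋] : ∀ n → suc n ≤ 2 * suc ⌊ n /2⌋
1+n≤2*[1+⌊n/2⌋] n = begin
  suc n                          ≡⟨ cong suc (⌊n/2⌋+⌈n/2⌉≡n n) ⟨
  suc (⌊ n /2⌋ + ⌈ n /2⌉)        ≤⟨ s≤s (+-monoʳ-≤ ⌊ n /2⌋ (⌊n/2⌋-mono (n≤1+n (suc n)))) ⟩
  suc (⌊ n /2⌋ + suc ⌊ n /2⌋)    ≡⟨ cong (suc ⌊ n /2⌋ +_) (+-identityʳ (suc ⌊ n /2⌋)) ⟨
  2 * suc ⌊ n /2⌋                ∎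
  where open ≤-Reasoning

-- With m = ⌊n/2⌋: (1+n)^(d+1) ≤ 2^(d+1) (1+m)^d (1+m) and 2^n ≥ 2^m 2^m > 2^m (1+m),
-- so the statement for d at m, with constant K 2^(d+1), gives it for d + 1 at n.
eventually-K*[1+n]^d<2^n : ∀ d K → Eventually (λ n → K * suc n ^ d < 2 ^ n)
eventually-K*[1+n]^d<2^n zero K = K , λ n K≤n → begin-strict
  K * 1     ≡⟨ *-identityʳ K ⟩
  K         <⟨ n<2^n K ⟩
  2 ^ K     ≤⟨ ^-monoʳ-≤ 2 K≤n ⟩
  2 ^ n     ∎
  where open ≤-Reasoning
eventually-K*[1+n]^d<2^n (suc d) K with eventually-K*[1+n]^d<2^n d (K * 2 ^ suc d)
... | N , bound = suc (N + N) , λ n 2N<n → step n (bound ⌊ n /2⌋ (N≤⌊n/2⌋ 2N<n))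
  where
  N≤⌊n/2⌋ : ∀ {n} → N + N < n → N ≤ ⌊ n /2⌋
  N≤⌊n/2⌋ 2N<n = subst (_≤ _) (sym (n≡⌈n+n/2⌉ N)) (⌊n/2⌋-mono 2N<n)
  step : ∀ n → K * 2 ^ suc d * suc ⌊ n /2⌋ ^ d < 2 ^ ⌊ n /2⌋ → K * suc n ^ suc d < 2 ^ n
  step n IH = begin-strict
    K * suc n ^ suc d                ≤⟨ *-monoʳ-≤ K (^-monoˡ-≤ (suc d) (1+n≤2*[1+⌊n/2⌋] n)) ⟩
    K * (2 * s) ^ suc d              ≡⟨ cong (K *_) (^-distribʳ-* 2 s (suc d)) ⟩
    K * (2 ^ suc d * (s * s ^ d))    ≡⟨ *-assoc K _ _ ⟨
    K * 2 ^ suc d * (s * s ^ d)      ≡⟨ x∙yz≈xz∙y (K * 2 ^ suc d) s (s ^ d) ⟩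
    K * 2 ^ suc d * s ^ d * s        <⟨ *-monoˡ-< s IH ⟩
    2 ^ m * s                        ≤⟨ *-monoʳ-≤ (2 ^ m) (n<2^n m) ⟩
    2 ^ m * 2 ^ m                    ≡⟨ ^-distribˡ-+-* 2 m m ⟨
    2 ^ (m + m)                      ≤⟨ ^-monoʳ-≤ 2 (⌊n/2⌋+⌊n/2⌋≤n n) ⟩
    2 ^ n                            ∎
    where
    open ≤-Reasoning
    m = ⌊ n /2⌋
    s = suc m

PolynomiallyBounded : (ℕ → ℕ) → Set
PolynomiallyBounded f = ∃₂ λ C d → ∀ n → f n ≤ C * suc n ^ d

polynomiallyBounded-^-* : ∀ {f} → PolynomiallyBounded f → ∀ k c →
                          PolynomiallyBounded (λ n → f n ^ k * c)
polynomiallyBounded-^-* {f} (C , d , f≤) k c = C ^ k * c , d * k , λ n → begin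
  f n ^ k * c                       ≤⟨ *-monoˡ-≤ c (^-monoˡ-≤ k (f≤ n)) ⟩
  (C * suc n ^ d) ^ k * c           ≡⟨ cong (_* c) (^-distribʳ-* C (suc n ^ d) k) ⟩
  C ^ k * (suc n ^ d) ^ k * c       ≡⟨ cong (λ t → C ^ k * t * c) (^-*-assoc (suc n) d k) ⟩
  C ^ k * suc n ^ (d * k) * c       ≡⟨ xy∙z≈xz∙y (C ^ k) _ c ⟩
  C ^ k * c * suc n ^ (d * k)       ∎
  where open ≤-Reasoning

polynomiallyBounded⇒ratio→0 : ∀ {b f} → 2 ≤ b → PolynomiallyBounded f → RatioTendsToZero f (b ^_)
polynomiallyBounded⇒ratio→0 {b} {f} 2≤b (C , d , f≤) k
  with eventually-K*[1+n]^d<2^n d (suc k * C)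
... | N , bound = N , λ n N≤n → begin-strict
  suc k * f n                    ≤⟨ *-monoʳ-≤ (suc k) (f≤ n) ⟩
  suc k * (C * suc n ^ d)        ≡⟨ *-assoc (suc k) C _ ⟨
  suc k * C * suc n ^ d          <⟨ bound n N≤n ⟩
  2 ^ n                          ≤⟨ ^-monoˡ-≤ n 2≤b ⟩
  b ^ n                          ∎
  where open ≤-Reasoning

-- ℕtoℚ normalises by a gcd that does not compute on a variable; after rewriting with
-- ℕtoℚ≡mkℚ, ℚ's operations reduce to operations on the integer numerators.
ℕtoℚ≡mkℚ : ∀ n → ℕtoℚ n ≡ mkℚ (ℤ.+ n) 0 (coprime-sym (1-coprimeTo n))
ℕtoℚ≡mkℚ n = ℚ.normalize-coprime (coprime-sym (1-coprimeTo n))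

ℕtoℚ-homo-+ : ∀ m n → ℕtoℚ (m + n) ≡ ℕtoℚ m ℚ.+ ℕtoℚ n
ℕtoℚ-homo-+ m n rewrite ℕtoℚ≡mkℚ m | ℕtoℚ≡mkℚ n = cong (ℚ._/ 1) (begin
  ℤ.+ (m + n)                          ≡⟨ ℤ.pos-+ m n ⟩
  ℤ.+ m ℤ.+ ℤ.+ n                      ≡⟨ cong₂ ℤ._+_ (ℤ.*-identityʳ (ℤ.+ m)) (ℤ.*-identityʳ (ℤ.+ n)) ⟨
  ℤ.+ m ℤ.* ℤ.+ 1 ℤ.+ ℤ.+ n ℤ.* ℤ.+ 1 ∎)
  where open ≡-Reasoning

ℕtoℚ-homo-* : ∀ m n → ℕtoℚ (m * n) ≡ ℕtoℚ m ℚ.* ℕtoℚ n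
ℕtoℚ-homo-* m n rewrite ℕtoℚ≡mkℚ m | ℕtoℚ≡mkℚ n = cong (ℚ._/ 1) (ℤ.pos-* m n)

ℕtoℚ-mono-≤ : ∀ {m n} → m ≤ n → ℕtoℚ m ℚ.≤ ℕtoℚ n
ℕtoℚ-mono-≤ {m} {n} m≤n rewrite ℕtoℚ≡mkℚ m | ℕtoℚ≡mkℚ n =
  ℚ.*≤* (subst₂ ℤ._≤_ (sym (ℤ.*-identityʳ (ℤ.+ m))) (sym (ℤ.*-identityʳ (ℤ.+ n))) (ℤ.+≤+ m≤n))

ℕtoℚ-cancel-≤ : ∀ {m n} → ℕtoℚ m ℚ.≤ ℕtoℚ n → m ≤ n
ℕtoℚ-cancel-≤ {m} {n} m≤n rewrite ℕtoℚ≡mkℚ m | ℕtoℚ≡mkℚ n =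
  ℤ.drop‿+≤+ (subst₂ ℤ._≤_ (ℤ.*-identityʳ (ℤ.+ m)) (ℤ.*-identityʳ (ℤ.+ n)) (ℚ.drop-*≤* m≤n))

ℕtoℚ-nonNeg : ∀ n → ℚ.NonNegative (ℕtoℚ n)
ℕtoℚ-nonNeg n rewrite ℕtoℚ≡mkℚ n = _

≤ℕtoℚ : ∀ p → ∃ λ n → p ℚ.≤ ℕtoℚ n
≤ℕtoℚ p@(mkℚ (ℤ.+ n) d-1 _) = n , subst (p ℚ.≤_) (sym (ℕtoℚ≡mkℚ n))
  (ℚ.*≤* (subst₂ ℤ._≤_ (ℤ.pos-* n 1) (ℤ.pos-* n (suc d-1)) (ℤ.+≤+ (*-monoʳ-≤ n (s≤s z≤n)))))
≤ℕtoℚ p@(mkℚ ℤ.-[1+ _ ] _ _) =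
  0 , ℚ.≤-trans (ℚ.<⇒≤ (ℚ.negative⁻¹ p)) (ℚ.nonNegative⁻¹ (ℕtoℚ 0) {{ℕtoℚ-nonNeg 0}})

m+n*[o*[1+n]^l]≤[m+o]*[1+n]^[1+l] : ∀ m o n l → m + n * (o * suc n ^ l) ≤ (m + o) * suc n ^ suc l
m+n*[o*[1+n]^l]≤[m+o]*[1+n]^[1+l] m o n l = begin
  m + n * (o * suc n ^ l)                       ≤⟨ +-mono-≤ (m≤m*n m (suc n ^ suc l) {{m^n≢0 (suc n) (suc l)}})
                                                            (*-monoˡ-≤ (o * suc n ^ l) (n≤1+n n)) ⟩
  m * suc n ^ suc l + suc n * (o * suc n ^ l)   ≡⟨ cong (m * suc n ^ suc l +_) (x∙yz≈y∙xz (suc n) o _) ⟩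
  m * suc n ^ suc l + o * suc n ^ suc l         ≡⟨ *-distribʳ-+ (suc n ^ suc l) m o ⟨
  (m + o) * suc n ^ suc l                       ∎
  where open ≤-Reasoning

evalPoly≤ : ∀ P → ∃ λ C → ∀ n → evalPoly P (ℕtoℚ n) ℚ.≤ ℕtoℚ (C * suc n ^ length P)
evalPoly≤ [] = 0 , λ _ → ℚ.≤-reflexive (sym (ℕtoℚ≡mkℚ 0))
evalPoly≤ (c ∷ cs) with ≤ℕtoℚ c | evalPoly≤ cs
... | c′ , c≤c′ | C , cs≤ = c′ + C , λ n → begin
  c ℚ.+ ℕtoℚ n ℚ.* evalPoly cs (ℕtoℚ n)
    ≤⟨ ℚ.+-mono-≤ c≤c′ (ℚ.*-monoˡ-≤-nonNeg (ℕtoℚ n) {{ℕtoℚ-nonNeg n}} (cs≤ n)) ⟩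
  ℕtoℚ c′ ℚ.+ ℕtoℚ n ℚ.* ℕtoℚ (C * suc n ^ l)
    ≡⟨ cong (ℕtoℚ c′ ℚ.+_) (ℕtoℚ-homo-* n _) ⟨
  ℕtoℚ c′ ℚ.+ ℕtoℚ (n * (C * suc n ^ l))
    ≡⟨ ℕtoℚ-homo-+ c′ _ ⟨
  ℕtoℚ (c′ + n * (C * suc n ^ l))
    ≤⟨ ℕtoℚ-mono-≤ (m+n*[o*[1+n]^l]≤[m+o]*[1+n]^[1+l] c′ C n l) ⟩
  ℕtoℚ ((c′ + C) * suc n ^ suc l) ∎
  where
  open ℚ.≤-Reasoning
  l = length cs

evalPoly⇒polynomiallyBounded : ∀ P F → (∀ n → evalPoly P (ℕtoℚ n) ≡ ℕtoℚ (F n)) →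
                               PolynomiallyBounded F
evalPoly⇒polynomiallyBounded P F P≡F with evalPoly≤ P
... | C , P≤ = C , length P , λ n → ℕtoℚ-cancel-≤ (subst (ℚ._≤ _) (P≡F n) (P≤ n))

corollary5p3 : (b : ℕ) → .{{_ : NonZero b}} → 2 ≤ b →
  ((F : ℕ → ℕ) →
    RatioTendsToZero (λ n → F n ^ (b ∸ 1) * b ^ (b ∸ 1)) (λ n → b ^ n) →
    FinitelyMany (IsDudeney b F))
  ×
  ((P : List ℚ) (F : ℕ → ℕ) →
    (∀ n → evalPoly P (ℕtoℚ n) ≡ ℕtoℚ (F n)) →
    FinitelyMany (IsDudeney b F))
corollary5p3 b 2≤b = dudeney-finitelyMany b , polynomialDudeney-finitelyMany
  where
  polynomialDudeney-finitelyMany : ∀ P F → (∀ n → evalPoly P (ℕtoℚ n) ≡ ℕtoℚ (F n)) →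
                                   FinitelyMany (IsDudeney b F)
  polynomialDudeney-finitelyMany P F P≡F =
    dudeney-finitelyMany b F (polynomiallyBounded⇒ratio→0 2≤b
      (polynomiallyBounded-^-* (evalPoly⇒polynomiallyBounded P F P≡F) (b ∸ 1) (b ^ (b ∸ 1))))
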